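{- Consider a rooted tree that starts as a star with a white center and $B$ black leaves. During any sequence of splits and contractions, the light depth of a node $u$ changes at most $\max\{0,\,6\lfloor\log_2\frac{B}{s(u)}\rfloor-1\}$ times.
   Context: Nodes are black or white; $N(u)$ is the neighbour set of $u$ (including its parent), $d(u)=|N(u)|$. $\mathrm{split}(u,M)$: given a white $u$ with $d(u)\ge2$ and $M\subset N(u)$, $1\le|M|\le\frac12 d(u)$, insert a new white child $v$ of $u$; let $M'=M$ if $u$ is the root or $\mathrm{parent}(u)\notin M$, else $M'=N(u)\setminus M$; make each node of $M'$ a child of $v$. $\mathrm{contract}$ of an edge from child $c$ to parent $p$: remove $c$, make its children children of $p$, turn $p$ black. Black weight $b(u)$: $0$ if $u$ is white, else the number of original black leaves contracted to form $u$. Size $s(u)=\sum_{w\in T_u}b(w)$ with $T_u$ the subtree of $u$ (splits and contractions do not change the size of any existing node). An edge from child $c$ to parent $p$ is heavy if $s(c)>\frac12 s(p)$, light otherwise. The light depth of $u$ is the number of light edges on the path from the root to $u$. -}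

module Defs where

open import Data.Nat using (ℕ; zero; suc; _+_; _*_; _∸_; _≤_; _≡ᵇ_; _≤ᵇ_)
open import Data.Nat.DivMod using (_/_)
open import Data.Nat.Logarithm using (⌊log₂_⌋)
open import Data.Bool using (Bool; true; false; if_then_else_; not)
open import Data.List using (List; []; _∷_; _++_; length; map; upTo; [_])
open import Data.Maybe using (Maybe; just; nothing)
open import Data.Product using (_×_; _,_)
open import Relation.Binary.PropositionalEquality using (_≡_)

-- Rooted trees with persistent node identities.
-- node id black? b cs : a node with identifier id, colour (true = black),
-- black weight b and list of children cs.  Order of children is irrelevant.

data Tree : Set where
  node : (id : ℕ) (black : Bool) (b : ℕ) (cs : List Tree) → Tree

mutual
  size : Tree → ℕ
  size (node _ _ b cs) = b + sizes cs

  sizes : List Tree → ℕ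
  sizes []       = 0
  sizes (c ∷ cs) = size c + sizes cs

-- light depth of the node with identifier u (nothing if u is not in the tree).
-- An edge c → p is light iff s(c) ≤ s(p)/2, i.e. 2 s(c) ≤ s(p).
mutual
  lightDepth : ℕ → Tree → Maybe ℕ
  lightDepth u (node i k b cs) =
    if i ≡ᵇ u then just 0 else lightDepthCh u (b + sizes cs) cs

  lightDepthCh : ℕ → ℕ → List Tree → Maybe ℕ
  lightDepthCh u sp [] = nothing
  lightDepthCh u sp (c ∷ cs) with lightDepth u c
  ... | just d  = just (d + (if 2 * size c ≤ᵇ sp then 1 else 0))
  ... | nothing = lightDepthCh u sp cs

mutual
  sizeOf : ℕ → Tree → Maybe ℕ
  sizeOf u (node i k b cs) =
    if i ≡ᵇ u then just (b + sizes cs) else sizeOfCh u cs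

  sizeOfCh : ℕ → List Tree → Maybe ℕ
  sizeOfCh u [] = nothing
  sizeOfCh u (c ∷ cs) with sizeOf u c
  ... | just s  = just s
  ... | nothing = sizeOfCh u cs

select : {A : Set} → List Bool → List A → List A
select []           _        = []
select (_ ∷ _)      []       = []
select (true ∷ bs)  (x ∷ xs) = x ∷ select bs xs
select (false ∷ bs) (x ∷ xs) = select bs xs

count : List Bool → ℕ
count []          = 0
count (true ∷ bs)  = suc (count bs)
count (false ∷ bs) = count bs

bit : Bool → ℕ
bit true  = 1
bit false = 0

data OneOf (R : Tree → Tree → Set) : List Tree → List Tree → Set where
  here  : ∀ {x y xs} → R x y → OneOf R (x ∷ xs) (y ∷ xs)
  there : ∀ {x xs ys} → OneOf R xs ys → OneOf R (x ∷ xs) (x ∷ ys)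

-- split(u, M) with fresh identifier f for the new node v.
-- The Bool index says whether the current node is the root.
-- M ⊆ N(u) is given by a mask over the children of u plus a bit
-- saying whether parent(u) ∈ M (which must be false at the root).
-- d(u) = #children + (0 if root, else 1).

data Split (f : ℕ) : Bool → Tree → Tree → Set where
  here : ∀ {r i b cs} (mask : List Bool) (pm : Bool) →
         length mask ≡ length cs →
         (r ≡ true → pm ≡ false) →
         2 ≤ length cs + (if r then 0 else 1) →
         1 ≤ count mask + bit pm →
         2 * (count mask + bit pm) ≤ length cs + (if r then 0 else 1) →
         -- M' = M ∩ children if parent ∉ M, else N(u) \ M = children ∖ M
         let mask' = if pm then map not mask else mask in
         Split f r (node i false b cs)
                   (node i false b (select (map not mask') cs
                                    ++ [ node f false 0 (select mask' cs) ]))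
  there : ∀ {r i k b cs cs'} →
          OneOf (Split f false) cs cs' →
          Split f r (node i k b cs) (node i k b cs')

data ContractHere : Tree → Tree → Set where
  here : ∀ {i k b j kc bc ds} (pre post : List Tree) →
         ContractHere (node i k b (pre ++ node j kc bc ds ∷ post))
                      (node i true (b + bc) (pre ++ post ++ ds))

data Contract : Tree → Tree → Set where
  here  : ∀ {t t'} → ContractHere t t' → Contract t t'
  there : ∀ {i k b cs cs'} → OneOf Contract cs cs' →
          Contract (node i k b cs) (node i k b cs')

-- States: a tree together with a counter supplying fresh identifiers.

State : Set
State = Tree × ℕ

data Step : State → State → Set where
  split    : ∀ {t t' f} → Split f true t t' → Step (t , f) (t' , suc f)
  contract : ∀ {t t' f} → Contract t t' → Step (t , f) (t' , f)

initial : ℕ → State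
initial B = node 0 false 0 (map (λ i → node (suc i) true 1 []) (upTo B)) , suc B

data Run (s : State) : State → Set where
  done : Run s s
  step : ∀ {t t'} → Run s t → Step t t' → Run s t'

-- number of steps in which u exists before and after and its light depth changes
differ : Maybe ℕ → Maybe ℕ → ℕ
differ (just a) (just c) = if a ≡ᵇ c then 0 else 1
differ _        _        = 0

changes : ∀ {s s'} → ℕ → Run s s' → ℕ
changes u done = 0
changes {s' = (t' , _)} u (step {t = (t , _)} r _) =
  changes u r + differ (lightDepth u t) (lightDepth u t')

-- max{0, 6⌊log₂(B / s)⌋ - 1}; note ⌊log₂(B/s)⌋ = ⌊log₂ ⌊B/s⌋⌋ when B/s ≥ 1,
-- and when B < s the true value is negative, so the max is 0 (⌊log₂ 0⌋ = 0).
-- s = 0 never occurs for an existing node (convention: bound 0).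
bound : ℕ → ℕ → ℕ
bound B zero    = 0
bound B (suc s) = 6 * ⌊log₂ (B / suc s) ⌋ ∸ 1

module Submission where

-- Fix a node u of size s; sizes never change, so s is fixed for the whole
-- run, and put K = ⌊log₂(B/s)⌋.  Everything happens on the root-to-u path,
-- recorded as the list of (size, colour) of its nodes.  One split or
-- contraction changes this path by one of four local moves (nothing, a node
-- turns black, a white node is inserted below a white node, a node is
-- contracted into its parent).  For each level j = 1..K with threshold
-- t = 2^j·s consider the crossing edge, the first edge of the path whose
-- child has size < t.  Every light edge of the path is the crossing edge at
-- exactly one level, namely the one whose band [t, 2t) contains its parent,
-- so the light depth is the number of levels whose crossing edge is light
-- with parent in the band.  A potential of at most 4 per level, depending
-- only on the crossing edge, drops under every move by at least the change
-- of that indicator.  Hence the number of changes is at most the initial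
-- potential 4K ≤ 6K - 1.

open import Defs
open import Data.Nat using (ℕ; zero; suc; _+_; _*_; _∸_; _^_; _≤_; _<_; z≤n; s≤s; _≤ᵇ_; _≡ᵇ_; _≤?_; _≟_)
open import Data.Nat.Properties
open import Data.Nat.DivMod using (_/_; m≡m%n+[m/n]*n; m%n<n)
open import Data.Nat.Logarithm using (⌊log₂_⌋; ⌊log₂⌋-mono-≤; ⌊log₂[2^n]⌋≡n)
open import Data.Nat.ListAction using (sum)
open import Data.Nat.ListAction.Properties using (sum-++)
open import Data.Nat.Tactic.RingSolver using (solve-∀)
open import Algebra.Properties.CommutativeSemigroup +-commutativeSemigroup using (interchange)
open import Data.Bool using (Bool; true; false; if_then_else_; not; _∧_; T)
open import Data.Bool.Properties using (∧-zeroʳ; ∧-identityʳ)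
open import Data.List using (List; []; _∷_; _++_; map; length; upTo; [_])
open import Data.List.Properties using (map-++; length-map; upTo-∷ʳ)
open import Data.List.Membership.Propositional using (_∈_)
open import Data.List.Membership.Propositional.Properties using (∈-++⁺ˡ; ∈-++⁺ʳ; ∈-++⁻)
open import Data.List.Relation.Unary.Any using (here; there)
open import Data.List.Relation.Unary.All using (All; []; _∷_) renaming (map to all-map)
open import Data.Maybe using (Maybe; just; nothing; _<∣>_)
import Data.Maybe as Maybe
open import Data.Maybe.Properties using (just-injective)
open import Data.Product using (_×_; _,_; proj₁; proj₂; Σ; ∃)
open import Data.Sum using (_⊎_; inj₁; inj₂; map₁; map₂)
open import Data.Unit using (⊤; tt)
open import Data.Empty using (⊥; ⊥-elim)
open import Relation.Nullary using (yes; no)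
open import Relation.Binary.PropositionalEquality hiding ([_])

T⇒≡true : ∀ {b} → T b → b ≡ true
T⇒≡true {true} _ = refl

≤ᵇ-true : ∀ {m n} → m ≤ n → (m ≤ᵇ n) ≡ true
≤ᵇ-true m≤n = T⇒≡true (≤⇒≤ᵇ m≤n)

≤ᵇ-sound : ∀ {m n} → (m ≤ᵇ n) ≡ true → m ≤ n
≤ᵇ-sound {m} {n} e = ≤ᵇ⇒≤ m n (subst T (sym e) tt)

≤ᵇ-false : ∀ {m n} → n < m → (m ≤ᵇ n) ≡ false
≤ᵇ-false {m} {n} n<m with m ≤ᵇ n in e
... | true  = ⊥-elim (<⇒≱ n<m (≤ᵇ-sound e))
... | false = refl

data Compare≤ (m n : ℕ) : Set where
  le : m ≤ n → (m ≤ᵇ n) ≡ true  → Compare≤ m n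
  gt : n < m → (m ≤ᵇ n) ≡ false → Compare≤ m n

compare≤ : ∀ m n → Compare≤ m n
compare≤ m n with m ≤? n
... | yes m≤n = le m≤n (≤ᵇ-true m≤n)
... | no  m≰n = gt (≰⇒> m≰n) (≤ᵇ-false (≰⇒> m≰n))

by-evaluation : ∀ {m n} → T (m ≤ᵇ n) → m ≤ n
by-evaluation {m} {n} = ≤ᵇ⇒≤ m n

change : ℕ → ℕ → ℕ
change a b = differ (just a) (just b)

≡ᵇ-refl : ∀ n → (n ≡ᵇ n) ≡ true
≡ᵇ-refl n = T⇒≡true (≡⇒≡ᵇ n n refl)

change-refl : ∀ a → change a a ≡ 0
change-refl a rewrite ≡ᵇ-refl a = refl

≡ᵇ-false : ∀ {a b} → a ≢ b → (a ≡ᵇ b) ≡ false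
≡ᵇ-false {a} {b} a≢b with a ≡ᵇ b in e
... | true  = ⊥-elim (a≢b (≡ᵇ⇒≡ a b (subst T (sym e) tt)))
... | false = refl

bit-≢ : ∀ {a b} → a ≢ b → bit (a ≡ᵇ b) ≡ 0
bit-≢ a≢b rewrite ≡ᵇ-false a≢b = refl

change-≢ : ∀ {a b} → a ≢ b → change a b ≡ 1
change-≢ a≢b rewrite ≡ᵇ-false a≢b = refl

change≤1 : ∀ a b → change a b ≤ 1
change≤1 a b with a ≡ᵇ b
... | true  = z≤n
... | false = s≤s z≤n

change-+ : ∀ a b c d → change (a + b) (c + d) ≤ change a c + change b d
change-+ a b c d with a ≟ c | b ≟ d
... | yes refl | yes refl rewrite change-refl (a + b) = z≤n
... | no a≢c   | _        rewrite change-≢ a≢c = ≤-trans (change≤1 (a + b) (c + d)) (m≤m+n 1 _)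
... | yes _    | no b≢d   rewrite change-≢ b≢d = ≤-trans (change≤1 (a + b) (c + d)) (m≤n+m 1 _)

sumTo : ℕ → (ℕ → ℕ) → ℕ
sumTo zero    f = 0
sumTo (suc K) f = sumTo K f + f (suc K)

sumTo-cong : ∀ K {f g} → (∀ j → f j ≡ g j) → sumTo K f ≡ sumTo K g
sumTo-cong zero    f≡g = refl
sumTo-cong (suc K) f≡g = cong₂ _+_ (sumTo-cong K f≡g) (f≡g (suc K))

sumTo-mono : ∀ K {f g} → (∀ j → f j ≤ g j) → sumTo K f ≤ sumTo K g
sumTo-mono zero    f≤g = ≤-refl
sumTo-mono (suc K) f≤g = +-mono-≤ (sumTo-mono K f≤g) (f≤g (suc K))

sumTo-+ : ∀ K f g → sumTo K (λ j → f j + g j) ≡ sumTo K f + sumTo K g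
sumTo-+ zero    f g = refl
sumTo-+ (suc K) f g rewrite sumTo-+ K f g =
  interchange (sumTo K f) (sumTo K g) (f (suc K)) (g (suc K))

sumTo-change : ∀ K f g → change (sumTo K f) (sumTo K g) ≤ sumTo K (λ j → change (f j) (g j))
sumTo-change zero    f g = z≤n
sumTo-change (suc K) f g =
  ≤-trans (change-+ (sumTo K f) (f (suc K)) (sumTo K g) (g (suc K)))
          (+-monoˡ-≤ _ (sumTo-change K f g))

sumTo-≤ : ∀ K f c → (∀ j → f j ≤ c) → sumTo K f ≤ K * c
sumTo-≤ zero    f c f≤c = z≤n
sumTo-≤ (suc K) f c f≤c =
  subst (sumTo K f + f (suc K) ≤_) (+-comm (K * c) c) (+-mono-≤ (sumTo-≤ K f c f≤c) (f≤c (suc K)))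

sumTo-zero : ∀ K f → (∀ j → j ≤ K → f j ≡ 0) → sumTo K f ≡ 0
sumTo-zero zero    f f≡0 = refl
sumTo-zero (suc K) f f≡0
  rewrite sumTo-zero K f (λ j j≤K → f≡0 j (m≤n⇒m≤1+n j≤K)) | f≡0 (suc K) ≤-refl = refl

-- Paths.  The path from the root to a node records, for every node on it,
-- its size and whether it is black.

Entry : Set
Entry = ℕ × Bool

Path : Set
Path = List Entry

light : ℕ → ℕ → ℕ
light a b = if 2 * b ≤ᵇ a then 1 else 0

lightEdges : Path → ℕ
lightEdges []                      = 0
lightEdges (_ ∷ [])                = 0
lightEdges ((a , _) ∷ (b , k) ∷ P) = lightEdges ((b , k) ∷ P) + light a b

Decreasing : Path → Set
Decreasing []                      = ⊤
Decreasing (_ ∷ [])                = ⊤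
Decreasing ((a , _) ∷ (b , k) ∷ P) = b ≤ a × Decreasing ((b , k) ∷ P)

top : Path → Maybe ℕ
top []            = nothing
top ((a , _) ∷ _) = just a

lastSize : Path → ℕ
lastSize []             = 0
lastSize ((a , _) ∷ []) = a
lastSize (_ ∷ e ∷ P)    = lastSize (e ∷ P)

-- The effect of one split or contraction on the path to a fixed node.
data Move : Path → Path → Set where
  stay    : ∀ {P} → Move P P
  -- a node of the path turns black (it absorbed a contracted child)
  blacken : ∀ a k P → Move ((a , k) ∷ P) ((a , true) ∷ P)
  -- a split inserts a new white node between a white node and its child
  insert  : ∀ a b c k P → c ≤ b → b ≤ a →
            Move ((a , false) ∷ (c , k) ∷ P) ((a , false) ∷ (b , false) ∷ (c , k) ∷ P)
  -- a node of the path is contracted into its parent, which turns black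
  delete  : ∀ a k b k′ c k″ P → c ≤ b → b ≤ a →
            Move ((a , k) ∷ (b , k′) ∷ (c , k″) ∷ P) ((a , true) ∷ (c , k″) ∷ P)
  below   : ∀ e {P P′} → Move P P′ → Move (e ∷ P) (e ∷ P′)

Move-top : ∀ {P P′} → Move P P′ → top P ≡ top P′
Move-top stay                       = refl
Move-top (blacken _ _ _)            = refl
Move-top (insert _ _ _ _ _ _ _)     = refl
Move-top (delete _ _ _ _ _ _ _ _ _) = refl
Move-top (below _ _)                = refl

Move-last : ∀ {P P′} → Move P P′ → lastSize P ≡ lastSize P′
Move-last stay                       = refl
Move-last (blacken a k [])           = refl
Move-last (blacken a k (_ ∷ _))      = refl
Move-last (insert _ _ _ _ _ _ _)     = refl
Move-last (delete _ _ _ _ _ _ _ _ _) = refl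
Move-last (below e {P} {P′} m)       = last-cons P P′ (Move-top m) (Move-last m)
  where
  last-cons : ∀ P P′ → top P ≡ top P′ → lastSize P ≡ lastSize P′ →
              lastSize (e ∷ P) ≡ lastSize (e ∷ P′)
  last-cons []      []      _  _ = refl
  last-cons (_ ∷ _) (_ ∷ _) _  eq = eq
  last-cons []      (_ ∷ _) () _
  last-cons (_ ∷ _) []      () _

-- An edge is (parent size, parent black?, child size).

Edge : Set
Edge = ℕ × Bool × ℕ

crossing : ℕ → Path → Maybe Edge
crossing t []                      = nothing
crossing t (_ ∷ [])                = nothing
crossing t ((a , k) ∷ (b , k′) ∷ P) =
  if suc b ≤ᵇ t then just (a , k , b) else crossing t ((b , k′) ∷ P)

inBand : ℕ → ℕ → Bool
inBand t a = (t ≤ᵇ a) ∧ (suc a ≤ᵇ 2 * t)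

isLight : ℕ → ℕ → Bool
isLight a b = 2 * b ≤ᵇ a

bandLight : ℕ → ℕ → ℕ → ℕ
bandLight t a b = bit (inBand t a ∧ isLight a b)

counted : ℕ → Maybe Edge → ℕ
counted t nothing            = 0
counted t (just (a , _ , b)) = bandLight t a b

-- It is chosen so
-- that every change of the crossing edge pays for a change of `counted`.
weight : (black band lightEdge : Bool) → ℕ
weight false false true  = 4
weight false false false = 2
weight false true  true  = 3
weight false true  false = 2
weight true  true  false = 2
weight true  true  true  = 1
weight true  false _     = 0

potential : ℕ → Maybe Edge → ℕ
potential t nothing            = 0
potential t (just (a , k , b)) = weight k (inBand t a) (isLight a b)

potential≤4 : ∀ t e → potential t e ≤ 4
potential≤4 t nothing = z≤n
potential≤4 t (just (a , k , b)) = weight≤4 k (inBand t a) (isLight a b)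
  where
  weight≤4 : ∀ k A L → weight k A L ≤ 4
  weight≤4 false false false = by-evaluation _
  weight≤4 false false true  = by-evaluation _
  weight≤4 false true  false = by-evaluation _
  weight≤4 false true  true  = by-evaluation _
  weight≤4 true  false _     = z≤n
  weight≤4 true  true  false = by-evaluation _
  weight≤4 true  true  true  = by-evaluation _

data EdgeChange (t : ℕ) : Maybe Edge → Maybe Edge → Set where
  same      : ∀ {e} → EdgeChange t e e
  blackened : ∀ {a k b} → EdgeChange t (just (a , k , b)) (just (a , true , b))
  -- after an insertion below a white parent: the parent may shrink (only
  -- to a size ≥ t) and the child may grow; both stay white
  lowered   : ∀ {a b a′ b′} → a′ ≤ a → b ≤ b′ → a′ ≡ a ⊎ t ≤ a′ →
              EdgeChange t (just (a , false , b)) (just (a′ , false , b′))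
  -- after a deletion: the parent may grow (only from a size ≥ t), the
  -- child may shrink, and the parent turns black
  raised    : ∀ {a k b a′ b′} → a ≤ a′ → b′ ≤ b → a′ ≡ a ⊎ t ≤ a →
              EdgeChange t (just (a , k , b)) (just (a′ , true , b′))

false≢true : false ≢ true
false≢true ()

weight-blacken : ∀ k A L → weight true A L ≤ weight k A L
weight-blacken false false false = z≤n
weight-blacken false false true  = z≤n
weight-blacken false true  false = ≤-refl
weight-blacken false true  true  = by-evaluation _
weight-blacken true  A     L     = ≤-refl

weight-lowered : ∀ A A′ L L′ → (A ≡ true → A′ ≡ true) → (L′ ≡ true → L ≡ true) →
                 weight false A′ L′ + change (bit (A ∧ L)) (bit (A′ ∧ L′)) ≤ weight false A L
weight-lowered true  false _     _     A⇒A′ _    = ⊥-elim (false≢true (A⇒A′ refl))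
weight-lowered _     _     false true  _    L′⇒L = ⊥-elim (false≢true (L′⇒L refl))
weight-lowered false false false false _ _ = by-evaluation _
weight-lowered false false true  false _ _ = by-evaluation _
weight-lowered false false true  true  _ _ = by-evaluation _
weight-lowered false true  false false _ _ = by-evaluation _
weight-lowered false true  true  false _ _ = by-evaluation _
weight-lowered false true  true  true  _ _ = by-evaluation _
weight-lowered true  true  false false _ _ = by-evaluation _
weight-lowered true  true  true  false _ _ = by-evaluation _
weight-lowered true  true  true  true  _ _ = by-evaluation _

weight-raised : ∀ A A′ L L′ → (A′ ≡ true → A ≡ true) → (L ≡ true → L′ ≡ true) →
                weight true A′ L′ + change (bit (A ∧ L)) (bit (A′ ∧ L′)) ≤ weight true A L
weight-raised false true  _     _     A′⇒A _    = ⊥-elim (false≢true (A′⇒A refl))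
weight-raised _     _     true  false _    L⇒L′ = ⊥-elim (false≢true (L⇒L′ refl))
weight-raised false false false false _ _ = z≤n
weight-raised false false false true  _ _ = z≤n
weight-raised false false true  true  _ _ = z≤n
weight-raised true  false false false _ _ = z≤n
weight-raised true  false false true  _ _ = z≤n
weight-raised true  false true  true  _ _ = by-evaluation _
weight-raised true  true  false false _ _ = by-evaluation _
weight-raised true  true  false true  _ _ = by-evaluation _
weight-raised true  true  true  true  _ _ = by-evaluation _

band-shrink : ∀ {t a a′} → inBand t a ≡ true → a′ ≤ a → a′ ≡ a ⊎ t ≤ a′ → inBand t a′ ≡ true
band-shrink inA _ (inj₁ refl) = inA
band-shrink {t} {a} {a′} inA a′≤a (inj₂ t≤a′) with t ≤ᵇ a
... | true = cong₂ _∧_ (≤ᵇ-true t≤a′) (≤ᵇ-true {n = 2 * t} (≤-trans (s≤s a′≤a) (≤ᵇ-sound {n = 2 * t} inA)))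

light-mono : ∀ {a b a′ b′} → isLight a′ b′ ≡ true → a′ ≤ a → b ≤ b′ → isLight a b ≡ true
light-mono light′ a′≤a b≤b′ = ≤ᵇ-true (≤-trans (*-monoʳ-≤ 2 b≤b′) (≤-trans (≤ᵇ-sound light′) a′≤a))

potential-pays : ∀ {t e e′} → EdgeChange t e e′ →
                 potential t e′ + change (counted t e) (counted t e′) ≤ potential t e
potential-pays {t} {e} same
  rewrite change-refl (counted t e) = ≤-reflexive (+-identityʳ (potential t e))
potential-pays {t} (blackened {a} {k} {b})
  rewrite change-refl (bandLight t a b) | +-identityʳ (weight true (inBand t a) (isLight a b)) =
  weight-blacken k (inBand t a) (isLight a b)
potential-pays {t} (lowered {a} {b} {a′} {b′} a′≤a b≤b′ stable) =
  weight-lowered (inBand t a) (inBand t a′) (isLight a b) (isLight a′ b′)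
    (λ inA → band-shrink inA a′≤a stable) (λ light′ → light-mono light′ a′≤a b≤b′)
potential-pays {t} (raised {a} {k} {b} {a′} {b′} a≤a′ b′≤b stable) =
  ≤-trans (weight-raised (inBand t a) (inBand t a′) (isLight a b) (isLight a′ b′)
             (λ inA′ → band-shrink inA′ a≤a′ (map₁ sym stable))
             (λ lightAB → light-mono lightAB a≤a′ b′≤b))
          (weight-blacken k (inBand t a) (isLight a b))

crossing-blacken : ∀ t a k P → EdgeChange t (crossing t ((a , k) ∷ P)) (crossing t ((a , true) ∷ P))
crossing-blacken t a k []             = same
crossing-blacken t a k ((b , _) ∷ P) with suc b ≤ᵇ t
... | true  = blackened
... | false = same

crossing-insert : ∀ t a b c k P → c ≤ b → b ≤ a →
                  EdgeChange t (crossing t ((a , false) ∷ (c , k) ∷ P))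
                               (crossing t ((a , false) ∷ (b , false) ∷ (c , k) ∷ P))
crossing-insert t a b c k P c≤b b≤a with compare≤ (suc c) t | compare≤ (suc b) t
... | le _   e | le _ e′ rewrite e | e′ = lowered ≤-refl c≤b (inj₁ refl)
... | le _   e | gt t≤b e′ rewrite e | e′ = lowered b≤a ≤-refl (inj₂ (≤-pred t≤b))
... | gt t≤c _ | le b<t _ = ⊥-elim (<⇒≱ t≤c (≤-trans (s≤s c≤b) b<t))
... | gt _   e | gt _ e′ rewrite e | e′ = same

crossing-delete : ∀ t a k b k′ c k″ P → c ≤ b → b ≤ a →
                  EdgeChange t (crossing t ((a , k) ∷ (b , k′) ∷ (c , k″) ∷ P))
                               (crossing t ((a , true) ∷ (c , k″) ∷ P))
crossing-delete t a k b k′ c k″ P c≤b b≤a with compare≤ (suc b) t | compare≤ (suc c) t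
... | le _    e | le _ e′ rewrite e | e′ = raised ≤-refl c≤b (inj₁ refl)
... | le b<t  _ | gt t≤c _ = ⊥-elim (<⇒≱ t≤c (≤-trans (s≤s c≤b) b<t))
... | gt t≤b e | le _ e′ rewrite e | e′ = raised b≤a ≤-refl (inj₂ (≤-pred t≤b))
... | gt _    e | gt _ e′ rewrite e | e′ = same

crossing-below : ∀ t e {P P′} → top P ≡ top P′ → EdgeChange t (crossing t P) (crossing t P′) →
                 EdgeChange t (crossing t (e ∷ P)) (crossing t (e ∷ P′))
crossing-below t e {[]}          {[]}           _    _ = same
crossing-below t e {(b , _) ∷ _} {(.b , _) ∷ _} refl c with suc b ≤ᵇ t
... | true  = same
... | false = c

move-crossing : ∀ t {P P′} → Move P P′ → EdgeChange t (crossing t P) (crossing t P′)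
move-crossing t stay                            = same
move-crossing t (blacken a k P)                 = crossing-blacken t a k P
move-crossing t (insert a b c k P c≤b b≤a)      = crossing-insert t a b c k P c≤b b≤a
move-crossing t (delete a k b k′ c k″ P c≤b b≤a) = crossing-delete t a k b k′ c k″ P c≤b b≤a
move-crossing t (below e m)                     = crossing-below t e (Move-top m) (move-crossing t m)

-- On a
-- decreasing path whose sizes lie in [s, 2^(K+1)·s), every light edge is the
-- counted crossing edge of exactly one level, so the light depth is the number
-- of levels whose crossing edge is counted.

threshold : ℕ → ℕ → ℕ
threshold s j = 2 ^ j * s

counts : ℕ → ℕ → Path → ℕ
counts K s P = sumTo K (λ j → counted (threshold s j) (crossing (threshold s j) P))

-- Below the threshold no later edge has its parent in the band.
counted-below : ∀ {t b k} P → b < t → Decreasing ((b , k) ∷ P) →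
                counted t (crossing t ((b , k) ∷ P)) ≡ 0
counted-below [] b<t _ = refl
counted-below {t} {b} ((c , _) ∷ P) b<t (c≤b , _)
  rewrite ≤ᵇ-true (≤-trans (s≤s c≤b) b<t) | ≤ᵇ-false {t} {b} b<t = refl

-- A light edge whose child has size ≥ t has its parent at ≥ 2t, above the band.
bandLight-above : ∀ {t a b} → t ≤ b → bandLight t a b ≡ 0
bandLight-above {t} {a} {b} t≤b with isLight a b in light
... | false = cong bit (∧-zeroʳ (inBand t a))
... | true rewrite ≤ᵇ-false {suc a} {2 * t} (s≤s (≤-trans (*-monoʳ-≤ 2 t≤b) (≤ᵇ-sound light)))
                 | ∧-zeroʳ (t ≤ᵇ a) = refl

counted-step : ∀ t a k b k′ P → Decreasing ((b , k′) ∷ P) →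
               counted t (crossing t ((a , k) ∷ (b , k′) ∷ P)) ≡
               counted t (crossing t ((b , k′) ∷ P)) + bandLight t a b
counted-step t a k b k′ P dec with compare≤ (suc b) t
... | le b<t e rewrite e | counted-below P b<t dec = refl
... | gt t≤b e rewrite e | bandLight-above {a = a} (≤-pred t≤b) = sym (+-identityʳ _)

above-lower-bands : ∀ {K s a} j → threshold s (suc K) ≤ a → j ≤ K →
                    bit (inBand (threshold s j) a) ≡ 0
above-lower-bands {K} {s} {a} j top≤a j≤K
  rewrite ≤ᵇ-false {suc a} {2 * threshold s j}
            (s≤s (≤-trans (≤-reflexive (sym (*-assoc 2 (2 ^ j) s)))
                 (≤-trans (*-monoˡ-≤ s (^-monoʳ-≤ 2 (s≤s j≤K))) top≤a)))
        | ∧-zeroʳ (threshold s j ≤ᵇ a) = refl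

bands-partition : ∀ K s a → 2 * s ≤ a → a < 2 ^ suc K * s →
                  sumTo K (λ j → bit (inBand (threshold s j) a)) ≡ 1
bands-partition zero    s a 2s≤a a<2s = ⊥-elim (<⇒≱ a<2s 2s≤a)
bands-partition (suc K) s a 2s≤a a<top with compare≤ (suc a) (threshold s (suc K))
... | le a<t e rewrite bands-partition K s a 2s≤a a<t | ≤ᵇ-false {threshold s (suc K)} {a} a<t = refl
... | gt t≤a _
  rewrite sumTo-zero K (λ j → bit (inBand (threshold s j) a)) (λ j → above-lower-bands j (≤-pred t≤a))
        | ≤ᵇ-true {threshold s (suc K)} {a} (≤-pred t≤a)
        | ≤ᵇ-true {suc a} {2 * threshold s (suc K)} (subst (suc a ≤_) (*-assoc 2 (2 ^ suc K) s) a<top) = refl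

bands-light : ∀ K s a b → s ≤ b → a < 2 ^ suc K * s →
              sumTo K (λ j → bandLight (threshold s j) a b) ≡ light a b
bands-light K s a b s≤b a<top with compare≤ (2 * b) a
... | le 2b≤a e rewrite e =
  trans (sumTo-cong K (λ j → cong bit (∧-identityʳ (inBand (threshold s j) a))))
        (bands-partition K s a (≤-trans (*-monoʳ-≤ 2 s≤b) 2b≤a) a<top)
... | gt _ e rewrite e =
  sumTo-zero K _ (λ j _ → cong bit (∧-zeroʳ (inBand (threshold s j) a)))

InRange : ℕ → ℕ → Entry → Set
InRange K s (a , _) = s ≤ a × a < 2 ^ suc K * s

lightEdges-counts : ∀ K s P → Decreasing P → All (InRange K s) P → lightEdges P ≡ counts K s P
lightEdges-counts K s []      _ _ = sym (sumTo-zero K _ (λ _ _ → refl))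
lightEdges-counts K s (_ ∷ []) _ _ = sym (sumTo-zero K _ (λ _ _ → refl))
lightEdges-counts K s ((a , k) ∷ (b , k′) ∷ P) (_ , dec) ((_ , a<top) ∷ ranges@((s≤b , _) ∷ _)) =
  begin
    lightEdges ((b , k′) ∷ P) + light a b
  ≡⟨ cong₂ _+_ (lightEdges-counts K s ((b , k′) ∷ P) dec ranges) (sym (bands-light K s a b s≤b a<top)) ⟩
    counts K s ((b , k′) ∷ P) + sumTo K (λ j → bandLight (threshold s j) a b)
  ≡⟨ sym (sumTo-+ K _ _) ⟩
    sumTo K (λ j → counted (threshold s j) (crossing (threshold s j) ((b , k′) ∷ P)) + bandLight (threshold s j) a b)
  ≡⟨ sumTo-cong K (λ j → sym (counted-step (threshold s j) a k b k′ P dec)) ⟩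
    counts K s ((a , k) ∷ (b , k′) ∷ P)
  ∎
  where open ≡-Reasoning

Φ : ℕ → ℕ → Path → ℕ
Φ K s P = sumTo K (λ j → potential (threshold s j) (crossing (threshold s j) P))

Φ≤ : ∀ K s P → Φ K s P ≤ K * 4
Φ≤ K s P = sumTo-≤ K _ 4 (λ j → potential≤4 (threshold s j) (crossing (threshold s j) P))

Φ-pays : ∀ K s {P P′} → Move P P′ →
         lightEdges P ≡ counts K s P → lightEdges P′ ≡ counts K s P′ →
         Φ K s P′ + change (lightEdges P) (lightEdges P′) ≤ Φ K s P
Φ-pays K s {P} {P′} m eq eq′ rewrite eq | eq′ =
  begin
    Φ K s P′ + change (counts K s P) (counts K s P′)
  ≤⟨ +-monoʳ-≤ (Φ K s P′) (sumTo-change K _ _) ⟩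
    Φ K s P′ + sumTo K (λ j → change (counted (t j) (crossing (t j) P)) (counted (t j) (crossing (t j) P′)))
  ≡⟨ sym (sumTo-+ K _ _) ⟩
    sumTo K (λ j → potential (t j) (crossing (t j) P′)
                   + change (counted (t j) (crossing (t j) P)) (counted (t j) (crossing (t j) P′)))
  ≤⟨ sumTo-mono K (λ j → potential-pays (move-crossing (t j) m)) ⟩
    Φ K s P
  ∎
  where
  open ≤-Reasoning
  t : ℕ → ℕ
  t = threshold s

between : ∀ e Q → Decreasing (e ∷ Q) → All (λ x → lastSize (e ∷ Q) ≤ proj₁ x × proj₁ x ≤ proj₁ e) (e ∷ Q)
between e       []      _             = (≤-refl , ≤-refl) ∷ []
between (a , _) (q ∷ Q) (q≤a , dec) with between q Q dec
... | from-q@((last≤q , _) ∷ _) = (≤-trans last≤q q≤a , ≤-refl) ∷ all-map (λ (lo , hi) → lo , ≤-trans hi q≤a) from-q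

lightEdges-root : ∀ e Q → All (λ x → 1 ≤ proj₁ x) Q → lastSize (e ∷ Q) ≡ 0 → lightEdges (e ∷ Q) ≡ 0
lightEdges-root e []      _   _      = refl
lightEdges-root e (q ∷ Q) pos last≡0 = ⊥-elim (<⇒≱ (last-positive q Q pos) (≤-reflexive last≡0))
  where
  last-positive : ∀ q Q → All (λ x → 1 ≤ proj₁ x) (q ∷ Q) → 1 ≤ lastSize (q ∷ Q)
  last-positive q []        (q>0 ∷ _)  = q>0
  last-positive q (q′ ∷ Q) (_ ∷ pos) = last-positive q′ Q pos

colour : Tree → Bool
colour (node _ k _ _) = k

entry : Tree → Entry
entry t = size t , colour t

-- The path strictly below the root of t to the node with identifier u, found
-- by the same depth-first search as lightDepth and sizeOf.  The full path to
-- u is entry t ∷ Q.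
mutual
  pathBelow : ℕ → Tree → Maybe Path
  pathBelow u (node i k b cs) = if i ≡ᵇ u then just [] else pathBelowCh u cs

  pathBelowCh : ℕ → List Tree → Maybe Path
  pathBelowCh u []       = nothing
  pathBelowCh u (c ∷ cs) = Maybe.map (entry c ∷_) (pathBelow u c) <∣> pathBelowCh u cs

mutual
  lightDepth-path : ∀ u t → lightDepth u t ≡ Maybe.map (λ Q → lightEdges (entry t ∷ Q)) (pathBelow u t)
  lightDepth-path u (node i k b cs) with i ≡ᵇ u
  ... | true  = refl
  ... | false = lightDepthCh-path u (b + sizes cs) k cs

  lightDepthCh-path : ∀ u sp k cs →
    lightDepthCh u sp cs ≡ Maybe.map (λ Q → lightEdges ((sp , k) ∷ Q)) (pathBelowCh u cs)
  lightDepthCh-path u sp k []       = refl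
  lightDepthCh-path u sp k (c ∷ cs) with lightDepth u c | pathBelow u c | lightDepth-path u c
  ... | just _  | just _  | refl = refl
  ... | nothing | nothing | refl = lightDepthCh-path u sp k cs

mutual
  sizeOf-path : ∀ u t → sizeOf u t ≡ Maybe.map (λ Q → lastSize (entry t ∷ Q)) (pathBelow u t)
  sizeOf-path u (node i k b cs) with i ≡ᵇ u
  ... | true  = refl
  ... | false = sizeOfCh-path u (b + sizes cs) k cs

  sizeOfCh-path : ∀ u sp k cs →
    sizeOfCh u cs ≡ Maybe.map (λ Q → lastSize ((sp , k) ∷ Q)) (pathBelowCh u cs)
  sizeOfCh-path u sp k []       = refl
  sizeOfCh-path u sp k (c ∷ cs) with sizeOf u c | pathBelow u c | sizeOf-path u c
  ... | just _  | just _  | refl = refl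
  ... | nothing | nothing | refl = sizeOfCh-path u sp k cs

data Below (u : ℕ) : Tree → Path → Set where
  here : ∀ {k b cs} → Below u (node u k b cs) []
  down : ∀ {i k b cs c Q} → c ∈ cs → Below u c Q → Below u (node i k b cs) (entry c ∷ Q)

total : (Tree → ℕ) → List Tree → ℕ
total g cs = sum (map g cs)

total-++ : ∀ g xs ys → total g (xs ++ ys) ≡ total g xs + total g ys
total-++ g xs ys = trans (cong sum (map-++ g xs ys)) (sum-++ (map g xs) (map g ys))

total-∈ : ∀ g {c cs} → c ∈ cs → g c ≤ total g cs
total-∈ g {cs = c ∷ cs}  (here refl) = m≤m+n (g c) (total g cs)
total-∈ g {cs = c′ ∷ cs} (there c∈cs) = ≤-trans (total-∈ g c∈cs) (m≤n+m (total g cs) (g c′))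

total-select : ∀ g m cs → length m ≡ length cs →
               total g (select m cs) + total g (select (map not m) cs) ≡ total g cs
total-select g []          []       _   = refl
total-select g (true ∷ m)  (c ∷ cs) len =
  trans (+-assoc (g c) _ _) (cong (g c +_) (total-select g m cs (suc-injective len)))
total-select g (false ∷ m) (c ∷ cs) len =
  trans (+-comm (total g (select m cs)) (g c + _))
        (trans (+-assoc (g c) _ _)
               (cong (g c +_) (trans (+-comm _ (total g (select m cs))) (total-select g m cs (suc-injective len)))))

select-∈ : ∀ {c : Tree} m cs → c ∈ select m cs → c ∈ cs
select-∈ (true ∷ m)  (c ∷ cs) (here c≡)  = here c≡
select-∈ (true ∷ m)  (c ∷ cs) (there c∈) = there (select-∈ m cs c∈)
select-∈ (false ∷ m) (c ∷ cs) c∈         = there (select-∈ m cs c∈)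

sizes-total : ∀ cs → sizes cs ≡ total size cs
sizes-total []       = refl
sizes-total (c ∷ cs) = cong (size c +_) (sizes-total cs)

child-size : ∀ {c cs} → c ∈ cs → size c ≤ sizes cs
child-size {cs = cs} c∈cs = subst (_ ≤_) (sym (sizes-total cs)) (total-∈ size c∈cs)

child≤parent : ∀ b {c cs} → c ∈ cs → size c ≤ b + sizes cs
child≤parent b {cs = cs} c∈cs = ≤-trans (child-size c∈cs) (m≤n+m (sizes cs) b)

Below-decreasing : ∀ {u t Q} → Below u t Q → Decreasing (entry t ∷ Q)
Below-decreasing here           = tt
Below-decreasing (down c∈cs Q↓) = child≤parent _ c∈cs , Below-decreasing Q↓

mutual
  occ : ℕ → Tree → ℕ
  occ v (node i _ _ cs) = bit (i ≡ᵇ v) + occs v cs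

  occs : ℕ → List Tree → ℕ
  occs v []       = 0
  occs v (c ∷ cs) = occ v c + occs v cs

occs-total : ∀ v cs → occs v cs ≡ total (occ v) cs
occs-total v []       = refl
occs-total v (c ∷ cs) = cong (occ v c +_) (occs-total v cs)

child-occ : ∀ {v c cs} → c ∈ cs → occ v c ≤ occs v cs
child-occ {v} {c} {cs} c∈cs = subst (occ v c ≤_) (sym (occs-total v cs)) (total-∈ (occ v) c∈cs)

Below-occ : ∀ {u t Q} → Below u t Q → 1 ≤ occ u t
Below-occ {u} here rewrite ≡ᵇ-refl u = s≤s z≤n
Below-occ {u} (down {i} {cs = cs} c∈cs Q↓) =
  ≤-trans (≤-trans (Below-occ Q↓) (child-occ c∈cs)) (m≤n+m (occs u cs) (bit (i ≡ᵇ u)))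

mutual
  pathBelow-sound : ∀ u t {Q} → pathBelow u t ≡ just Q → Below u t Q
  pathBelow-sound u (node i k b cs) found with i ≡ᵇ u in i≡u
  pathBelow-sound u (node i k b cs) refl | true rewrite ≡ᵇ⇒≡ i u (subst T (sym i≡u) tt) = here
  ... | false = pathBelowCh-sound u cs found

  pathBelowCh-sound : ∀ u {i k b} cs {Q} → pathBelowCh u cs ≡ just Q → Below u (node i k b cs) Q
  pathBelowCh-sound u (c ∷ cs) found with pathBelow u c in found-c
  pathBelowCh-sound u (c ∷ cs) refl | just Q = down (here refl) (pathBelow-sound u c found-c)
  pathBelowCh-sound u {i} {k} {b} (c ∷ cs) found | nothing with pathBelowCh-sound u {i} {k} {b} cs found
  ...   | down c∈cs Q↓ = down (there c∈cs) Q↓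
  ...   | here         = here

mutual
  pathBelow-complete : ∀ {u t Q} → Below u t Q → ∃ λ Q′ → pathBelow u t ≡ just Q′
  pathBelow-complete {u} here rewrite ≡ᵇ-refl u = [] , refl
  pathBelow-complete {u} (down {i} c∈cs Q↓) with i ≡ᵇ u
  ... | true  = [] , refl
  ... | false = pathBelowCh-complete c∈cs Q↓

  pathBelowCh-complete : ∀ {u c cs Q} → c ∈ cs → Below u c Q → ∃ λ Q′ → pathBelowCh u cs ≡ just Q′
  pathBelowCh-complete {u} {cs = c′ ∷ cs} c∈cs Q↓ with pathBelow u c′ in found
  ... | just _ = _ , refl
  pathBelowCh-complete (here refl) Q↓ | nothing with pathBelow-complete Q↓
  ... | _ , found′ with trans (sym found) found′
  ...   | ()
  pathBelowCh-complete (there c∈cs) Q↓ | nothing = pathBelowCh-complete c∈cs Q↓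

mutual
  Below-unique : ∀ {u t Q₁ Q₂} → occ u t ≤ 1 → Below u t Q₁ → Below u t Q₂ → Q₁ ≡ Q₂
  Below-unique once here here = refl
  Below-unique {u} once here (down {cs = cs} c∈cs Q↓) rewrite ≡ᵇ-refl u =
    ⊥-elim (<⇒≱ (s≤s (≤-trans (Below-occ Q↓) (child-occ c∈cs))) once)
  Below-unique {u} once (down {cs = cs} c∈cs Q↓) here rewrite ≡ᵇ-refl u =
    ⊥-elim (<⇒≱ (s≤s (≤-trans (Below-occ Q↓) (child-occ c∈cs))) once)
  Below-unique {u} once (down {i} {cs = cs} c₁∈ Q₁↓) (down c₂∈ Q₂↓) =
    Below-uniqueCh (≤-trans (m≤n+m (occs u cs) (bit (i ≡ᵇ u))) once) c₁∈ c₂∈ Q₁↓ Q₂↓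

  Below-uniqueCh : ∀ {u cs c₁ c₂ Q₁ Q₂} → occs u cs ≤ 1 → c₁ ∈ cs → c₂ ∈ cs →
                   Below u c₁ Q₁ → Below u c₂ Q₂ → entry c₁ ∷ Q₁ ≡ entry c₂ ∷ Q₂
  Below-uniqueCh {u} {c ∷ cs} once (here refl) (here refl) Q₁↓ Q₂↓ =
    cong (entry c ∷_) (Below-unique (≤-trans (m≤m+n (occ u c) (occs u cs)) once) Q₁↓ Q₂↓)
  Below-uniqueCh once (here refl) (there c₂∈) Q₁↓ Q₂↓ =
    ⊥-elim (<⇒≱ (+-mono-≤ (Below-occ Q₁↓) (≤-trans (Below-occ Q₂↓) (child-occ c₂∈))) once)
  Below-uniqueCh once (there c₁∈) (here refl) Q₁↓ Q₂↓ =
    ⊥-elim (<⇒≱ (+-mono-≤ (Below-occ Q₂↓) (≤-trans (Below-occ Q₁↓) (child-occ c₁∈))) once)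
  Below-uniqueCh {u} {c ∷ cs} once (there c₁∈) (there c₂∈) Q₁↓ Q₂↓ =
    Below-uniqueCh (≤-trans (m≤n+m (occs u cs) (occ u c)) once) c₁∈ c₂∈ Q₁↓ Q₂↓

mutual
  Positive : Tree → Set
  Positive (node _ _ _ cs) = PositiveChildren cs

  PositiveChildren : List Tree → Set
  PositiveChildren []       = ⊤
  PositiveChildren (c ∷ cs) = 1 ≤ size c × Positive c × PositiveChildren cs

positive-++ : ∀ xs {ys} → PositiveChildren xs → PositiveChildren ys → PositiveChildren (xs ++ ys)
positive-++ []       _                 pos-ys = pos-ys
positive-++ (x ∷ xs) (x>0 , x+ , xs+) pos-ys = x>0 , x+ , positive-++ xs xs+ pos-ys

positive-++ˡ : ∀ xs {ys} → PositiveChildren (xs ++ ys) → PositiveChildren xs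
positive-++ˡ []       _                 = tt
positive-++ˡ (x ∷ xs) (x>0 , x+ , rest) = x>0 , x+ , positive-++ˡ xs rest

positive-++ʳ : ∀ xs {ys} → PositiveChildren (xs ++ ys) → PositiveChildren ys
positive-++ʳ []       pos          = pos
positive-++ʳ (x ∷ xs) (_ , _ , rest) = positive-++ʳ xs rest

positive-select : ∀ m cs → PositiveChildren cs → PositiveChildren (select m cs)
positive-select []          cs       _                 = tt
positive-select (_ ∷ m)     []       _                 = tt
positive-select (true ∷ m)  (c ∷ cs) (c>0 , c+ , cs+) = c>0 , c+ , positive-select m cs cs+
positive-select (false ∷ m) (c ∷ cs) (_ , _ , cs+)     = positive-select m cs cs+

positive-∈ : ∀ {c cs} → c ∈ cs → PositiveChildren cs → 1 ≤ size c × Positive c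
positive-∈ (here refl)  (c>0 , c+ , _) = c>0 , c+
positive-∈ (there c∈cs) (_ , _ , cs+)  = positive-∈ c∈cs cs+

positive-selection : ∀ m cs → length m ≡ length cs → PositiveChildren cs → 1 ≤ count m →
                     1 ≤ sizes (select m cs)
positive-selection []          []       _   _             ()
positive-selection (true ∷ m)  (c ∷ cs) _   (c>0 , _ , _) _ = ≤-trans c>0 (m≤m+n (size c) _)
positive-selection (false ∷ m) (c ∷ cs) len (_ , _ , cs+) nonempty =
  positive-selection m cs (suc-injective len) cs+ nonempty

Below-positive : ∀ {u t Q} → Below u t Q → Positive t → All (λ e → 1 ≤ proj₁ e) Q
Below-positive here           _   = []
Below-positive (down c∈cs Q↓) pos = proj₁ (positive-∈ c∈cs pos) ∷ Below-positive Q↓ (proj₂ (positive-∈ c∈cs pos))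

newNode : ℕ → List Bool → List Tree → Tree
newNode f m cs = node f false 0 (select m cs)

splitChildren : ℕ → List Bool → List Tree → List Tree
splitChildren f m cs = select (map not m) cs ++ [ newNode f m cs ]

sizes-split : ∀ f m cs → length m ≡ length cs → sizes (splitChildren f m cs) ≡ sizes cs
sizes-split f m cs len =
  begin
    sizes (splitChildren f m cs)
  ≡⟨ trans (sizes-total (splitChildren f m cs)) (total-++ size (select (map not m) cs) _) ⟩
    total size (select (map not m) cs) + (sizes (select m cs) + 0)
  ≡⟨ cong (λ x → total size (select (map not m) cs) + x)
          (trans (+-identityʳ _) (sizes-total (select m cs))) ⟩
    total size (select (map not m) cs) + total size (select m cs)
  ≡⟨ trans (+-comm (total size (select (map not m) cs)) _) (total-select size m cs len) ⟩
    total size cs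
  ≡⟨ sym (sizes-total cs) ⟩
    sizes cs
  ∎
  where open ≡-Reasoning

occs-split : ∀ v f m cs → length m ≡ length cs → occs v (splitChildren f m cs) ≡ occs v cs + bit (f ≡ᵇ v)
occs-split v f m cs len =
  begin
    occs v (splitChildren f m cs)
  ≡⟨ trans (occs-total v (splitChildren f m cs)) (total-++ (occ v) (select (map not m) cs) _) ⟩
    total (occ v) (select (map not m) cs) + ((bit (f ≡ᵇ v) + occs v (select m cs)) + 0)
  ≡⟨ cong (λ x → total (occ v) (select (map not m) cs) + (bit (f ≡ᵇ v) + x + 0))
          (occs-total v (select m cs)) ⟩
    total (occ v) (select (map not m) cs) + ((bit (f ≡ᵇ v) + total (occ v) (select m cs)) + 0)
  ≡⟨ rearrange (total (occ v) (select (map not m) cs)) (bit (f ≡ᵇ v)) (total (occ v) (select m cs)) ⟩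
    (total (occ v) (select m cs) + total (occ v) (select (map not m) cs)) + bit (f ≡ᵇ v)
  ≡⟨ cong (_+ bit (f ≡ᵇ v)) (trans (total-select (occ v) m cs len) (sym (occs-total v cs))) ⟩
    occs v cs + bit (f ≡ᵇ v)
  ∎
  where
  open ≡-Reasoning
  rearrange : ∀ a x b → a + ((x + b) + 0) ≡ (b + a) + x
  rearrange = solve-∀

applied : Bool → List Bool → List Bool
applied pm mask = if pm then map not mask else mask

applied-length : ∀ pm mask (cs : List Tree) → length mask ≡ length cs → length (applied pm mask) ≡ length cs
applied-length true  mask cs len = trans (length-map not mask) len
applied-length false mask cs len = len

count-not : ∀ m → count (map not m) + count m ≡ length m
count-not []          = refl
count-not (true ∷ m)  = trans (+-suc (count (map not m)) (count m)) (cong suc (count-not m))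
count-not (false ∷ m) = cong suc (count-not m)

-- The new node receives at least one child: if parent(u) ∉ M then M′ = M
-- is nonempty; otherwise M′ = N(u) ∖ M and |M| ≤ d(u)/2 < d(u).
applied-nonempty : ∀ r pm mask (cs : List Tree) → length mask ≡ length cs → (r ≡ true → pm ≡ false) →
                   1 ≤ count mask + bit pm → 2 * (count mask + bit pm) ≤ length cs + (if r then 0 else 1) →
                   1 ≤ count (applied pm mask)
applied-nonempty r     false mask cs _   _        |M|≥1 _ = subst (1 ≤_) (+-identityʳ (count mask)) |M|≥1
applied-nonempty true  true  mask cs _   root⇒pm∉ _    _ = ⊥-elim (false≢true (sym (root⇒pm∉ refl)))
applied-nonempty false true  mask cs len _        _    |M|≤d/2 with count (map not mask) in rest
... | suc _ = s≤s z≤n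
... | zero  = ⊥-elim (no-room (count mask) (subst (λ L → 2 * (count mask + 1) ≤ L + 1) L≡c |M|≤d/2))
  where
  L≡c : length cs ≡ count mask
  L≡c = trans (sym len) (trans (sym (count-not mask)) (cong (_+ count mask) rest))
  no-room : ∀ c → 2 * (c + 1) ≤ c + 1 → ⊥
  no-room c = <⇒≱ (m<m+n (c + 1) (≤-trans (m≤n+m 1 c) (m≤m+n (c + 1) 0)))

sizes-select≤ : ∀ m cs → length m ≡ length cs → sizes (select m cs) ≤ sizes cs
sizes-select≤ m cs len =
  subst₂ _≤_ (sym (sizes-total (select m cs))) (sym (sizes-total cs))
         (subst (total size (select m cs) ≤_) (total-select size m cs len) (m≤m+n _ _))

-- Tracing the path to u back through a step: the path before the step and
-- the move turning it into the path after the step.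
Preimage : ℕ → Tree → Tree → Path → Set
Preimage u t t′ Q′ = Σ Path λ Q → Below u t Q × Move (entry t ∷ Q) (entry t′ ∷ Q′)

PreimageCh : ℕ → List Tree → Tree → Path → Set
PreimageCh u cs c′ Q′ = Σ Tree λ c → c ∈ cs × Preimage u c c′ Q′

resize : ∀ {a a′ k k′ P P′} → a′ ≡ a → Move ((a , k) ∷ P) ((a , k′) ∷ P′) → Move ((a , k) ∷ P) ((a′ , k′) ∷ P′)
resize refl m = m

mutual
  split-size : ∀ {f r t t′} → Split f r t t′ → size t′ ≡ size t
  split-size (here {b = b} {cs} mask pm len _ _ _ _) =
    cong (b +_) (sizes-split _ (applied pm mask) cs (applied-length pm mask cs len))
  split-size (there {b = b} inner) = cong (b +_) (splitCh-size inner)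

  splitCh-size : ∀ {f cs cs′} → OneOf (Split f false) cs cs′ → sizes cs′ ≡ sizes cs
  splitCh-size (here {xs = xs} inner) = cong (_+ sizes xs) (split-size inner)
  splitCh-size (there {x = x} steps) = cong (size x +_) (splitCh-size steps)

mutual
  split-occ : ∀ {f r t t′} v → Split f r t t′ → occ v t′ ≡ occ v t + bit (f ≡ᵇ v)
  split-occ {f} v (here {i = i} {cs = cs} mask pm len _ _ _ _) =
    trans (cong (bit (i ≡ᵇ v) +_) (occs-split v f (applied pm mask) cs (applied-length pm mask cs len)))
          (sym (+-assoc (bit (i ≡ᵇ v)) (occs v cs) (bit (f ≡ᵇ v))))
  split-occ {f} v (there {i = i} {cs = cs} steps) =
    trans (cong (bit (i ≡ᵇ v) +_) (splitCh-occ v steps)) (sym (+-assoc (bit (i ≡ᵇ v)) (occs v cs) (bit (f ≡ᵇ v))))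

  splitCh-occ : ∀ {f cs cs′} v → OneOf (Split f false) cs cs′ → occs v cs′ ≡ occs v cs + bit (f ≡ᵇ v)
  splitCh-occ {f} v (here {x} {xs = xs} inner) =
    trans (cong (_+ occs v xs) (split-occ v inner))
          (trans (+-assoc (occ v x) _ _) (trans (cong (occ v x +_) (+-comm (bit (f ≡ᵇ v)) _)) (sym (+-assoc (occ v x) _ _))))
  splitCh-occ {f} v (there {x} {xs} steps) =
    trans (cong (occ v x +_) (splitCh-occ v steps)) (sym (+-assoc (occ v x) (occs v xs) (bit (f ≡ᵇ v))))

mutual
  split-positive : ∀ {f r t t′} → Split f r t t′ → Positive t → Positive t′
  split-positive (here {r} {cs = cs} mask pm len root⇒pm∉ _ |M|≥1 |M|≤d/2) pos =
    positive-++ (select (map not m′) cs) (positive-select (map not m′) cs pos)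
      (positive-selection m′ cs len′ pos (applied-nonempty r pm mask cs len root⇒pm∉ |M|≥1 |M|≤d/2) ,
       positive-select m′ cs pos , tt)
    where
    m′ : List Bool
    m′ = applied pm mask
    len′ : length m′ ≡ length cs
    len′ = applied-length pm mask cs len
  split-positive (there steps) pos = splitCh-positive steps pos

  splitCh-positive : ∀ {f cs cs′} → OneOf (Split f false) cs cs′ → PositiveChildren cs → PositiveChildren cs′
  splitCh-positive (here inner)   (x>0 , x+ , rest) = subst (1 ≤_) (sym (split-size inner)) x>0 , split-positive inner x+ , rest
  splitCh-positive (there steps) (x>0 , x+ , rest) = x>0 , x+ , splitCh-positive steps rest

mutual
  split-path : ∀ {f r t t′ u Q′} → Split f r t t′ → Below u t′ Q′ → u ≡ f ⊎ Preimage u t t′ Q′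
  split-path s@(here _ _ _ _ _ _ _) here = inj₂ ([] , here , resize (split-size s) stay)
  split-path s@(here {cs = cs} mask pm len _ _ _ _) (down c′∈ Q↓)
    with ∈-++⁻ (select (map not (applied pm mask)) cs) c′∈
  ... | inj₁ kept = inj₂ (_ , down (select-∈ (map not (applied pm mask)) cs kept) Q↓ , resize (split-size s) stay)
  ... | inj₂ (there ())
  ... | inj₂ (here refl) with Q↓
  ...   | here = inj₁ refl
  ...   | down {c = c} moved Q↓′ =
    inj₂ (_ , down (select-∈ (applied pm mask) cs moved) Q↓′ ,
          resize (split-size s)
            (insert _ _ _ (colour c) _ (child-size moved)
                    (≤-trans (sizes-select≤ (applied pm mask) cs (applied-length pm mask cs len)) (m≤n+m _ _))))
  split-path s@(there _) here = inj₂ ([] , here , resize (split-size s) stay)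
  split-path s@(there {k = k} {b} {cs} steps) (down c′∈ Q↓) with splitCh-path steps c′∈ Q↓
  ... | inj₁ u≡f = inj₁ u≡f
  ... | inj₂ (c , c∈ , Q , Q↓′ , m) = inj₂ (entry c ∷ Q , down c∈ Q↓′ , resize (split-size s) (below (b + sizes cs , k) m))

  splitCh-path : ∀ {f cs cs′ c′ u Q′} → OneOf (Split f false) cs cs′ → c′ ∈ cs′ → Below u c′ Q′ →
                 u ≡ f ⊎ PreimageCh u cs c′ Q′
  splitCh-path (here {x} inner) (here refl) Q↓ with split-path inner Q↓
  ... | inj₁ u≡f = inj₁ u≡f
  ... | inj₂ pre = inj₂ (x , here refl , pre)
  splitCh-path (here inner)   (there c′∈) Q↓ = inj₂ (_ , there c′∈ , _ , Q↓ , stay)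
  splitCh-path (there steps) (here refl) Q↓ = inj₂ (_ , here refl , _ , Q↓ , stay)
  splitCh-path (there steps) (there c′∈) Q↓ with splitCh-path steps c′∈ Q↓
  ... | inj₁ u≡f             = inj₁ u≡f
  ... | inj₂ (c , c∈ , pre) = inj₂ (c , there c∈ , pre)

sizes-++ : ∀ xs ys → sizes (xs ++ ys) ≡ sizes xs + sizes ys
sizes-++ xs ys =
  trans (sizes-total (xs ++ ys))
        (trans (total-++ size xs ys) (sym (cong₂ _+_ (sizes-total xs) (sizes-total ys))))

occs-++ : ∀ v xs ys → occs v (xs ++ ys) ≡ occs v xs + occs v ys
occs-++ v xs ys =
  trans (occs-total v (xs ++ ys))
        (trans (total-++ (occ v) xs ys) (sym (cong₂ _+_ (occs-total v xs) (occs-total v ys))))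

contractHere-size : ∀ {t t′} → ContractHere t t′ → size t′ ≡ size t
contractHere-size (here {b = b} {j = j} {kc = kc} {bc = bc} {ds = ds} pre post)
  rewrite sizes-++ pre (post ++ ds) | sizes-++ post ds | sizes-++ pre (node j kc bc ds ∷ post) =
  rearrange b bc (sizes pre) (sizes post) (sizes ds)
  where
  rearrange : ∀ b bc P Q D → b + bc + (P + (Q + D)) ≡ b + (P + (bc + D + Q))
  rearrange = solve-∀

contractHere-occ : ∀ {t t′} v → ContractHere t t′ → occ v t′ ≤ occ v t
contractHere-occ v (here {i} {j = j} {kc = kc} {bc = bc} {ds = ds} pre post)
  rewrite occs-++ v pre (post ++ ds) | occs-++ v post ds | occs-++ v pre (node j kc bc ds ∷ post) =
  subst (bit (i ≡ᵇ v) + (occs v pre + (occs v post + occs v ds)) ≤_)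
        (rearrange (bit (i ≡ᵇ v)) (bit (j ≡ᵇ v)) (occs v pre) (occs v post) (occs v ds))
        (m≤n+m _ (bit (j ≡ᵇ v)))
  where
  rearrange : ∀ a bj P Q D → bj + (a + (P + (Q + D))) ≡ a + (P + (bj + D + Q))
  rearrange = solve-∀

contractHere-positive : ∀ {t t′} → ContractHere t t′ → Positive t → Positive t′
contractHere-positive (here pre post) pos =
  positive-++ pre (positive-++ˡ pre pos) (positive-++ post rest ds+)
  where
  after-pre = positive-++ʳ pre pos
  ds+  = proj₁ (proj₂ after-pre)
  rest = proj₂ (proj₂ after-pre)

-- After a contraction the path of u arose by a move: the parent turns black,
-- and if the contracted node was on the path it is deleted from it.
contractHere-path : ∀ {t t′ u Q′} → ContractHere t t′ → Below u t′ Q′ → Preimage u t t′ Q′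
contractHere-path c@(here {k = k} pre post) here = [] , here , resize (contractHere-size c) (blacken _ k [])
contractHere-path c@(here {k = k} {b = b} {kc = kc} {bc = bc} {ds = ds} pre post) (down {c = c′} c′∈ Q↓)
  with ∈-++⁻ pre c′∈
... | inj₁ in-pre = _ , down (∈-++⁺ˡ in-pre) Q↓ , resize (contractHere-size c) (blacken _ k _)
... | inj₂ c′∈′ with ∈-++⁻ post c′∈′
...   | inj₁ in-post = _ , down (∈-++⁺ʳ pre (there in-post)) Q↓ , resize (contractHere-size c) (blacken _ k _)
...   | inj₂ in-ds   =
  _ , down (∈-++⁺ʳ pre (here refl)) (down in-ds Q↓) ,
  resize (contractHere-size c)
    (delete _ k _ kc _ (colour c′) _ (child≤parent bc in-ds)
            (child≤parent b {cs = pre ++ node _ kc bc ds ∷ post} (∈-++⁺ʳ pre (here refl))))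

mutual
  contract-size : ∀ {t t′} → Contract t t′ → size t′ ≡ size t
  contract-size (here c)                  = contractHere-size c
  contract-size (there {b = b} contracts) = cong (b +_) (contractCh-size contracts)

  contractCh-size : ∀ {cs cs′} → OneOf Contract cs cs′ → sizes cs′ ≡ sizes cs
  contractCh-size (here {xs = xs} inner) = cong (_+ sizes xs) (contract-size inner)
  contractCh-size (there {x = x} rest)   = cong (size x +_) (contractCh-size rest)

mutual
  contract-occ : ∀ {t t′} v → Contract t t′ → occ v t′ ≤ occ v t
  contract-occ v (here c)                  = contractHere-occ v c
  contract-occ v (there {i = i} contracts) = +-monoʳ-≤ (bit (i ≡ᵇ v)) (contractCh-occ v contracts)

  contractCh-occ : ∀ {cs cs′} v → OneOf Contract cs cs′ → occs v cs′ ≤ occs v cs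
  contractCh-occ v (here {xs = xs} inner) = +-monoˡ-≤ (occs v xs) (contract-occ v inner)
  contractCh-occ v (there {x = x} rest)   = +-monoʳ-≤ (occ v x) (contractCh-occ v rest)

mutual
  contract-positive : ∀ {t t′} → Contract t t′ → Positive t → Positive t′
  contract-positive (here c)          = contractHere-positive c
  contract-positive (there contracts) = contractCh-positive contracts

  contractCh-positive : ∀ {cs cs′} → OneOf Contract cs cs′ → PositiveChildren cs → PositiveChildren cs′
  contractCh-positive (here inner) (x>0 , x+ , rest) =
    subst (1 ≤_) (sym (contract-size inner)) x>0 , contract-positive inner x+ , rest
  contractCh-positive (there rest) (x>0 , x+ , rest+) = x>0 , x+ , contractCh-positive rest rest+

mutual
  contract-path : ∀ {t t′ u Q′} → Contract t t′ → Below u t′ Q′ → Preimage u t t′ Q′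
  contract-path (here c) Q↓ = contractHere-path c Q↓
  contract-path c@(there _) here = [] , here , resize (contract-size c) stay
  contract-path c@(there {k = k} {b} {cs} contracts) (down c′∈ Q↓) with contractCh-path contracts c′∈ Q↓
  ... | (x , x∈ , Q , Q↓′ , m) = entry x ∷ Q , down x∈ Q↓′ , resize (contract-size c) (below (b + sizes cs , k) m)

  contractCh-path : ∀ {cs cs′ c′ u Q′} → OneOf Contract cs cs′ → c′ ∈ cs′ → Below u c′ Q′ → PreimageCh u cs c′ Q′
  contractCh-path (here {x} inner) (here refl) Q↓ = x , here refl , contract-path inner Q↓
  contractCh-path (here inner)     (there c′∈) Q↓ = _ , there c′∈ , _ , Q↓ , stay
  contractCh-path (there rest)     (here refl) Q↓ = _ , here refl , _ , Q↓ , stay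
  contractCh-path (there rest)     (there c′∈) Q↓ with contractCh-path rest c′∈ Q↓
  ... | (x , x∈ , pre) = x , there x∈ , pre

leaf : ℕ → Tree
leaf i = node (suc i) true 1 []

starLeaves : ℕ → List Tree
starLeaves n = map leaf (upTo n)

starLeaves-suc : ∀ n → starLeaves (suc n) ≡ starLeaves n ++ [ leaf n ]
starLeaves-suc n = trans (cong (map leaf) (sym (upTo-∷ʳ n))) (map-++ leaf (upTo n) [ n ])

occs-star-suc : ∀ n v → occs v (starLeaves (suc n)) ≡ occs v (starLeaves n) + bit (suc n ≡ᵇ v)
occs-star-suc n v =
  trans (cong (occs v) (starLeaves-suc n))
        (trans (occs-++ v (starLeaves n) [ leaf n ])
               (cong (occs v (starLeaves n) +_) (trans (+-identityʳ _) (+-identityʳ _))))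

-- The leaf n has identifier n + 1, which is neither 0 nor beyond n + 1.
last≢ : ∀ {n v} → v ≡ 0 ⊎ suc n < v → suc n ≢ v
last≢ (inj₁ refl) ()
last≢ (inj₂ n<v)  refl = <-irrefl refl n<v

star-fresh : ∀ n v → v ≡ 0 ⊎ n < v → occs v (starLeaves n) ≡ 0
star-fresh zero    v _ = refl
star-fresh (suc n) v outside
  rewrite occs-star-suc n v | star-fresh n v (map₂ (≤-trans (n≤1+n (suc n))) outside)
        | bit-≢ (last≢ outside) = refl

star-unique : ∀ n v → occs v (starLeaves n) ≤ 1
star-unique zero    v = z≤n
star-unique (suc n) v rewrite occs-star-suc n v with suc n ≟ v
... | yes refl rewrite star-fresh n (suc n) (inj₂ ≤-refl) | ≡ᵇ-refl (suc n) = ≤-refl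
... | no  n≢v  rewrite bit-≢ n≢v = subst (_≤ 1) (sym (+-identityʳ _)) (star-unique n v)

star-size : ∀ n → sizes (starLeaves n) ≡ n
star-size zero    = refl
star-size (suc n) =
  trans (cong sizes (starLeaves-suc n))
        (trans (sizes-++ (starLeaves n) [ leaf n ]) (trans (cong (_+ 1) (star-size n)) (+-comm n 1)))

star-positive : ∀ n → PositiveChildren (starLeaves n)
star-positive zero    = tt
star-positive (suc n) =
  subst PositiveChildren (sym (starLeaves-suc n)) (positive-++ (starLeaves n) (star-positive n) (s≤s z≤n , tt , tt))

record WellFormed (B : ℕ) (t : Tree) (f : ℕ) : Set where
  field
    unique   : ∀ v → occ v t ≤ 1
    fresh    : ∀ v → f ≤ v → occ v t ≡ 0
    positive : Positive t
    rootSize : size t ≡ B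
open WellFormed

initial-wellFormed : ∀ B → WellFormed B (proj₁ (initial B)) (suc B)
initial-wellFormed B = record
  { unique   = λ { zero    → ≤-reflexive (cong suc (star-fresh B 0 (inj₁ refl)))
                 ; (suc v) → star-unique B (suc v) }
  ; fresh    = λ { (suc v) B<v → star-fresh B (suc v) (inj₂ B<v) }
  ; positive = star-positive B
  ; rootSize = star-size B
  }

step-wellFormed : ∀ {B t f t′ f′} → Step (t , f) (t′ , f′) → WellFormed B t f → WellFormed B t′ f′
step-wellFormed {f = f} {t′} (split s) wf = record
  { unique   = unique′
  ; fresh    = λ v f<v → trans (split-occ v s)
                          (cong₂ _+_ (fresh wf v (≤-trans (n≤1+n f) f<v)) (bit-≢ (<⇒≢ f<v)))
  ; positive = split-positive s (positive wf)
  ; rootSize = trans (split-size s) (rootSize wf)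
  }
  where
  unique′ : ∀ v → occ v t′ ≤ 1
  unique′ v rewrite split-occ v s with f ≟ v
  ... | yes refl rewrite fresh wf f ≤-refl | ≡ᵇ-refl f = ≤-refl
  ... | no  f≢v  rewrite bit-≢ f≢v = subst (_≤ 1) (sym (+-identityʳ _)) (unique wf v)
step-wellFormed (contract c) wf = record
  { unique   = λ v → ≤-trans (contract-occ v c) (unique wf v)
  ; fresh    = λ v f≤v → n≤0⇒n≡0 (≤-trans (contract-occ v c) (≤-reflexive (fresh wf v f≤v)))
  ; positive = contract-positive c (positive wf)
  ; rootSize = trans (contract-size c) (rootSize wf)
  }

step-counter : ∀ {t f t′ f′} → Step (t , f) (t′ , f′) → f ≤ f′
step-counter (split _)    = n≤1+n _
step-counter (contract _) = ≤-refl

reachable-wellFormed : ∀ {B t f} → Run (initial B) (t , f) → WellFormed B t f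
reachable-wellFormed {B} done       = initial-wellFormed B
reachable-wellFormed (step r st) = step-wellFormed st (reachable-wellFormed r)

levels : ℕ → ℕ → ℕ
levels B zero    = 0
levels B (suc s) = ⌊log₂ (B / suc s) ⌋

pot : ℕ → Path → ℕ
pot B P = Φ (levels B (lastSize P)) (lastSize P) P

below-next-power : ∀ n → n < 2 ^ suc ⌊log₂ n ⌋
below-next-power n with 2 ^ suc ⌊log₂ n ⌋ ≤? n
... | no  ≰ = ≰⇒> ≰
... | yes ≤ = ⊥-elim (<-irrefl refl (subst (_≤ ⌊log₂ n ⌋) (⌊log₂[2^n]⌋≡n (suc ⌊log₂ n ⌋)) (⌊log₂⌋-mono-≤ ≤)))

below-top-level : ∀ B s → B < 2 ^ suc (levels B (suc s)) * suc s
below-top-level B s = ≤-trans B<next (*-monoˡ-≤ (suc s) (below-next-power (B / suc s)))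
  where
  B<next : B < suc (B / suc s) * suc s
  B<next = subst (_< suc (B / suc s) * suc s) (sym (m≡m%n+[m/n]*n B (suc s)))
                 (+-monoˡ-< ((B / suc s) * suc s) (m%n<n B (suc s)))

path-counts : ∀ {B t f u Q} → WellFormed B t f → Below u t Q →
              let P = entry t ∷ Q in lightEdges P ≡ counts (levels B (lastSize P)) (lastSize P) P
path-counts {B} {t} {Q = Q} wf Q↓ with lastSize (entry t ∷ Q) in last≡
... | zero  = lightEdges-root (entry t) Q (Below-positive Q↓ (positive wf)) last≡
... | suc s = lightEdges-counts (levels B (suc s)) (suc s) (entry t ∷ Q) (Below-decreasing Q↓)
                (all-map (λ {x} → in-range {x}) (between (entry t) Q (Below-decreasing Q↓)))
  where
  in-range : ∀ {x} → lastSize (entry t ∷ Q) ≤ proj₁ x × proj₁ x ≤ size t → InRange (levels B (suc s)) (suc s) x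
  in-range {x} (lo , hi) = subst (_≤ proj₁ x) last≡ lo , ≤-<-trans (subst (proj₁ x ≤_) (rootSize wf) hi) (below-top-level B s)

pot-pays : ∀ B {P P′} → Move P P′ →
           lightEdges P  ≡ counts (levels B (lastSize P)) (lastSize P) P →
           lightEdges P′ ≡ counts (levels B (lastSize P′)) (lastSize P′) P′ →
           pot B P′ + change (lightEdges P) (lightEdges P′) ≤ pot B P
pot-pays B {P} {P′} m counts-P counts-P′ with lastSize P | Move-last m
... | _ | refl = Φ-pays (levels B (lastSize P′)) (lastSize P′) m counts-P counts-P′

lightDepth-Below : ∀ {u t Q} → occ u t ≤ 1 → Below u t Q → lightDepth u t ≡ just (lightEdges (entry t ∷ Q))
lightDepth-Below {u} {t} once Q↓ with pathBelow-complete Q↓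
... | Q₀ , found rewrite lightDepth-path u t | found
                       | Below-unique once (pathBelow-sound u t found) Q↓ = refl

lightDepth-absent : ∀ {u t} → occ u t ≡ 0 → lightDepth u t ≡ nothing
lightDepth-absent {u} {t} none rewrite lightDepth-path u t with pathBelow u t in found
... | nothing = refl
... | just Q  = ⊥-elim (<⇒≱ (Below-occ (pathBelow-sound u t found)) (≤-reflexive none))

step-path : ∀ {ta fa t f u Q′} → Step (ta , fa) (t , f) → Below u t Q′ → u ≡ fa ⊎ Preimage u ta t Q′
step-path (split s)    Q′↓ = split-path s Q′↓
step-path (contract c) Q′↓ = inj₂ (contract-path c Q′↓)

sized-path : ∀ u t {su} → sizeOf u t ≡ just su → Σ Path λ Q → Below u t Q × su ≡ lastSize (entry t ∷ Q)
sized-path u t size≡ with pathBelow u t in found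
... | nothing = ⊥-elim (just≢nothing (trans (sym size≡) (trans (sizeOf-path u t) (cong (Maybe.map _) found))))
  where
  just≢nothing : ∀ {x : ℕ} → just x ≢ nothing
  just≢nothing ()
... | just Q = Q , pathBelow-sound u t found ,
               just-injective (trans (sym size≡) (trans (sizeOf-path u t) (cong (Maybe.map _) found)))

module Budget (B u : ℕ) where

  -- Before u is created its light depth never changes (it does not exist).
  unborn : ∀ {t f} (r : Run (initial B) (t , f)) → f ≤ u → changes u r ≡ 0
  unborn done _ = refl
  unborn {t} (step {t = ta , fa} r st) f≤u =
    cong₂ _+_ (unborn r fa≤u)
              (cong (λ d → differ d (lightDepth u t)) (lightDepth-absent {u} {ta} (fresh (reachable-wellFormed r) u fa≤u)))
    where
    fa≤u = ≤-trans (step-counter st) f≤u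

  budget : ∀ {t f} (r : Run (initial B) (t , f)) → ∀ {Q} → Below u t Q →
           changes u r + pot B (entry t ∷ Q) ≤ levels B (lastSize (entry t ∷ Q)) * 4
  budget {t} done {Q} _ = Φ≤ (levels B (lastSize (entry t ∷ Q))) (lastSize (entry t ∷ Q)) (entry t ∷ Q)
  budget {t} (step {t = ta , fa} r st) {Q′} Q′↓ with step-path st Q′↓
  ... | inj₁ refl =
    begin
      changes u r + differ (lightDepth u ta) (lightDepth u t) + pot B Pb
    ≡⟨ cong₂ (λ c d → c + d + pot B Pb) (unborn r ≤-refl)
             (cong (λ d → differ d (lightDepth u t)) (lightDepth-absent {u} {ta} (fresh wfa u ≤-refl))) ⟩
      pot B Pb
    ≤⟨ Φ≤ (levels B (lastSize Pb)) (lastSize Pb) Pb ⟩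
      levels B (lastSize Pb) * 4
    ∎
    where
    open ≤-Reasoning
    wfa = reachable-wellFormed r
    Pb  = entry t ∷ Q′
  ... | inj₂ (Q , Q↓ , m) =
    begin
      changes u r + differ (lightDepth u ta) (lightDepth u t) + pot B Pb
    ≡⟨ cong (λ d → changes u r + d + pot B Pb)
            (cong₂ differ (lightDepth-Below (unique wfa u) Q↓) (lightDepth-Below (unique wf u) Q′↓)) ⟩
      changes u r + change (lightEdges Pa) (lightEdges Pb) + pot B Pb
    ≡⟨ trans (+-assoc (changes u r) _ _) (cong (changes u r +_) (+-comm _ (pot B Pb))) ⟩
      changes u r + (pot B Pb + change (lightEdges Pa) (lightEdges Pb))
    ≤⟨ +-monoʳ-≤ (changes u r) (pot-pays B m (path-counts wfa Q↓) (path-counts wf Q′↓)) ⟩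
      changes u r + pot B Pa
    ≤⟨ budget r Q↓ ⟩
      levels B (lastSize Pa) * 4
    ≡⟨ cong (λ s → levels B s * 4) (Move-last m) ⟩
      levels B (lastSize Pb) * 4
    ∎
    where
    open ≤-Reasoning
    wfa = reachable-wellFormed r
    wf  = step-wellFormed st wfa
    Pa  = entry ta ∷ Q
    Pb  = entry t ∷ Q′

levels-within-bound : ∀ B s → levels B s * 4 ≤ bound B s
levels-within-bound B zero    = z≤n
levels-within-bound B (suc s) = four≤six-minus-one (levels B (suc s))
  where
  four≤six-minus-one : ∀ K → K * 4 ≤ 6 * K ∸ 1
  four≤six-minus-one zero    = z≤n
  four≤six-minus-one (suc m) =
    m+n≤o⇒m≤o∸n (suc m * 4) (subst (suc m * 4 + 1 ≤_) (sym (six m)) (+-monoʳ-≤ (suc m * 4) (s≤s z≤n)))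
    where
    six : ∀ m → 6 * suc m ≡ suc m * 4 + (2 + 2 * m)
    six = solve-∀

lemma39 : ∀ (B : ℕ) → ∀ {t f} (r : Run (initial B) (t , f)) (u su : ℕ) →
          sizeOf u t ≡ just su → changes u r ≤ bound B su
lemma39 B {t} r u su size≡ with sized-path u t size≡
... | Q , Q↓ , refl =
  begin
    changes u r
  ≤⟨ m≤m+n (changes u r) _ ⟩
    changes u r + pot B (entry t ∷ Q)
  ≤⟨ Budget.budget B u r Q↓ ⟩
    levels B (lastSize (entry t ∷ Q)) * 4
  ≤⟨ levels-within-bound B (lastSize (entry t ∷ Q)) ⟩
    bound B (lastSize (entry t ∷ Q))
  ∎
  where open ≤-Reasoning
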